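{- Let $G$ be a graph and let $G_{(2)}$ be the graph obtained from $G$ by subdividing each edge an even number of times, i.e. each edge $uv$ of $G$ is replaced by an induced path from $u$ to $v$ whose number of new internal vertices is even (the even number may differ from edge to edge). Then $G$ is $1$-extendable if and only if $G_{(2)}$ is $1$-extendable.
   Context: Graphs are finite, simple and undirected. A maximum independent set (MIS) of a graph is an independent set (set of pairwise non-adjacent vertices) of maximum size. A graph is $1$-extendable if every vertex belongs to some maximum independent set. -}

module Defs where

open import Data.Nat using (ℕ; suc; _*_; _≤_)
open import Data.Fin using (Fin; toℕ; _<_)
open import Data.Bool using (Bool; true; false)
open import Data.Product using (Σ; Σ-syntax; ∃; ∃-syntax; _×_; _,_)
open import Data.Sum using (_⊎_; inj₁; inj₂)
open import Data.List using (List; length)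
open import Data.List.Membership.Propositional using (_∈_)
open import Data.List.Relation.Unary.Unique.Propositional using (Unique)
open import Relation.Binary.PropositionalEquality using (_≡_)
open import Relation.Nullary using (¬_)

-- A vertex set is a duplicate-free list; its size is its
-- length.

Independent : {V : Set} → (V → V → Set) → List V → Set
Independent E S = Unique S × (∀ {x y} → x ∈ S → y ∈ S → ¬ E x y)

MaximumIndependent : {V : Set} → (V → V → Set) → List V → Set
MaximumIndependent E S =
  Independent E S × (∀ T → Independent E T → length T ≤ length S)

OneExtendable : {V : Set} → (V → V → Set) → Set
OneExtendable {V} E = ∀ (v : V) → ∃[ S ] (MaximumIndependent E S × v ∈ S)

record SimpleGraph (n : ℕ) : Set where
  field
    adj     : Fin n → Fin n → Bool
    symm    : ∀ u v → adj u v ≡ adj v u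
    irrefl  : ∀ u → adj u u ≡ false

open SimpleGraph public

Adj : ∀ {n} → SimpleGraph n → Fin n → Fin n → Set
Adj G u v = adj G u v ≡ true

-- An edge {u,v} of G, represented canonically with u < v.
Edge : ∀ {n} → SimpleGraph n → Fin n → Fin n → Set
Edge G u v = u < v × Adj G u v

-- Even subdivision G_(2).
-- k u v : for an edge {u,v} with u < v, the edge is replaced by a path
-- u - p_0 - p_1 - ... - p_(2 k u v - 1) - v with 2 * k u v new internal
-- vertices (an arbitrary even number, possibly 0).  Values of k at
-- non-edges / u ≥ v are irrelevant.

SubV : ∀ {n} → SimpleGraph n → (Fin n → Fin n → ℕ) → Set
SubV {n} G k =
  Fin n ⊎ (Σ[ u ∈ Fin n ] Σ[ v ∈ Fin n ] (Edge G u v × Fin (2 * k u v)))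

AttachAdj : ∀ {n} → (k : Fin n → Fin n → ℕ) →
            Fin n → (u v : Fin n) → Fin (2 * k u v) → Set
AttachAdj k x u v i = (x ≡ u × toℕ i ≡ 0) ⊎ (x ≡ v × suc (toℕ i) ≡ 2 * k u v)

SubAdj : ∀ {n} → (G : SimpleGraph n) → (k : Fin n → Fin n → ℕ) →
         SubV G k → SubV G k → Set
SubAdj G k (inj₁ x) (inj₁ y) =
  (Edge G x y × k x y ≡ 0) ⊎ (Edge G y x × k y x ≡ 0)
SubAdj G k (inj₁ x) (inj₂ (u , v , _ , i)) =
  AttachAdj k x u v i
SubAdj G k (inj₂ (u , v , _ , i)) (inj₁ x) =
  AttachAdj k x u v i
SubAdj G k (inj₂ (u , v , _ , i))
           (inj₂ (u' , v' , _ , j)) =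
  u ≡ u' × v ≡ v' × (suc (toℕ i) ≡ toℕ j ⊎ suc (toℕ j) ≡ toℕ i)

{-# OPTIONS --safe #-}
module Submission where

-- Let K be the sum of k u v over the edges u v of G.  An independent set S of G
-- lifts to an independent set of G_(2) of size |S| + K: on the path of each edge
-- u v take every second internal vertex, starting next to u if u ∉ S and one step
-- later if u ∈ S.  Conversely, an independent set T of G_(2) projects to an
-- independent set of G of size at least |T| - K that contains a prescribed original
-- vertex w ∈ T: keep the original vertices of T and delete one end, never w, of each
-- edge of G between them.  Hence α(G_(2)) = α(G) + K, both maps send maximum
-- independent sets to maximum independent sets, and every vertex of G_(2) lies in
-- the lift of a maximum independent set containing a suitable end of its edge.

open import Defs
open import Axiom.UniquenessOfIdentityProofs.WithK using (uip)
import Data.Bool.Properties as Bool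
open import Data.Bool using (true)
open import Data.Empty using (⊥-elim)
open import Data.Fin as Fin using (Fin; toℕ; fromℕ<)
import Data.Fin.Properties as Finₚ
open import Data.List
  using (List; []; _∷_; _++_; map; length; concatMap; filter; allFin; tabulate; cartesianProduct)
open import Data.List.Properties using (length-++; length-map)
open import Data.List.Membership.Propositional using (_∈_; find; lose)
open import Data.List.Membership.Propositional.Properties
  using ( ∈-++⁺ˡ; ∈-++⁺ʳ; ∈-++⁻; ∈-map⁺; ∈-map⁻; ∈-∃++; ∈-concatMap⁺; ∈-concatMap⁻
        ; ∈-cartesianProduct⁺; ∈-tabulate⁺; ∈-tabulate⁻; ∈-filter⁺; ∈-filter⁻; ∈-allFin)
open import Data.List.Relation.Binary.Subset.Propositional using (_⊆_)
import Data.List.Relation.Unary.All as All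
open import Data.List.Relation.Unary.Any using (here; there)
open import Data.List.Relation.Unary.AllPairs using ([]; _∷_)
open import Data.List.Relation.Unary.Unique.Propositional using (Unique)
open import Data.List.Relation.Unary.Unique.Propositional.Properties
  using (++⁺; map⁺; tabulate⁺; allFin⁺; filter⁺; cartesianProduct⁺)
open import Data.Nat using (ℕ; zero; suc; _+_; _*_; _∸_; _≤_; _<_; z≤n; s≤s; z<s; s<s; s<s⁻¹; pred; ⌊_/2⌋)
open import Data.Nat.Properties
open import Data.Product using (∃; ∃₂; _×_; _,_; proj₂)
open import Data.Sum using (_⊎_; inj₁; inj₂)
import Data.Sum as Sum
open import Data.Sum.Properties using (inj₁-injective; inj₂-injective)
open import Function.Base using (_∘_)
open import Function.Bundles using (_⇔_; mk⇔)
open import Relation.Binary.Definitions using (tri<; tri≈; tri>)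
open import Relation.Binary.PropositionalEquality
open import Relation.Nullary using (¬_; Dec; yes; no; contradiction)
open import Relation.Nullary.Decidable using (_×-dec_; _⊎-dec_; ¬?)

module _ {A : Set} where

  Unique⇒length-≤ : {xs ys : List A} → Unique xs → xs ⊆ ys → length xs ≤ length ys
  Unique⇒length-≤ {[]} _ _ = z≤n
  Unique⇒length-≤ {x ∷ xs} {ys} (x∉xs ∷ xs!) xs⊆ys with ∈-∃++ (xs⊆ys (here refl))
  ... | ys₁ , ys₂ , refl = begin
    suc (length xs)                ≤⟨ s≤s (Unique⇒length-≤ xs! xs⊆ys₁++ys₂) ⟩
    suc (length (ys₁ ++ ys₂))      ≡⟨ cong suc (length-++ ys₁) ⟩
    suc (length ys₁ + length ys₂)  ≡⟨ +-suc (length ys₁) (length ys₂) ⟨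
    length ys₁ + suc (length ys₂)  ≡⟨ length-++ ys₁ ⟨
    length (ys₁ ++ x ∷ ys₂)        ∎
    where
    open ≤-Reasoning
    xs⊆ys₁++ys₂ : xs ⊆ ys₁ ++ ys₂
    xs⊆ys₁++ys₂ p with ∈-++⁻ ys₁ (xs⊆ys (there p))
    ... | inj₁ q          = ∈-++⁺ˡ q
    ... | inj₂ (here refl) = contradiction refl (All.lookup x∉xs p)
    ... | inj₂ (there q)  = ∈-++⁺ʳ ys₁ q

module _ {A B : Set} where

  concatMap⁺ : {f : A → List B} (key : B → A) {xs : List A} → Unique xs →
               (∀ x → Unique (f x)) → (∀ {x y} → y ∈ f x → key y ≡ x) →
               Unique (concatMap f xs)
  concatMap⁺ key {[]} [] _ _ = []
  concatMap⁺ {f} key {x ∷ xs} (x∉xs ∷ xs!) f! f-key =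
    ++⁺ (f! x) (concatMap⁺ key xs! f! f-key) disjoint
    where
    disjoint : ∀ {y} → ¬ (y ∈ f x × y ∈ concatMap f xs)
    disjoint (p , q) =
      let x′ , x′∈xs , q′ = find (∈-concatMap⁻ f q)
      in All.lookup x∉xs x′∈xs (trans (sym (f-key p)) (f-key q′))

  map⁺-on : (f : A → B) {xs : List A} → Unique xs →
            (∀ {x y} → x ∈ xs → y ∈ xs → f x ≡ f y → x ≡ y) → Unique (map f xs)
  map⁺-on f {[]} [] _ = []
  map⁺-on f {x ∷ xs} (x∉xs ∷ xs!) f-inj =
    All.tabulate fx∉ ∷ map⁺-on f xs! (λ p q → f-inj (there p) (there q))
    where
    fx∉ : ∀ {z} → z ∈ map f xs → f x ≢ z
    fx∉ p fx≡z =
      let y , y∈xs , z≡fy = ∈-map⁻ f p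
      in All.lookup x∉xs y∈xs (f-inj (here refl) (there y∈xs) (trans fx≡z z≡fy))

  length-≤-injectiveOn : (f : A → B) {xs : List A} {ys : List B} → Unique xs →
                         (∀ {x} → x ∈ xs → f x ∈ ys) →
                         (∀ {x y} → x ∈ xs → y ∈ xs → f x ≡ f y → x ≡ y) →
                         length xs ≤ length ys
  length-≤-injectiveOn f {xs} {ys} xs! f∈ys f-inj = begin
    length xs          ≡⟨ length-map f xs ⟨
    length (map f xs)  ≤⟨ Unique⇒length-≤ (map⁺-on f xs! f-inj) image⊆ys ⟩
    length ys          ∎
    where
    open ≤-Reasoning
    image⊆ys : map f xs ⊆ ys
    image⊆ys p with ∈-map⁻ f p
    ... | _ , x∈xs , refl = f∈ys x∈xs

Consecutive : ℕ → ℕ → Set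
Consecutive m n = suc m ≡ n ⊎ suc n ≡ m

m<2n⇒⌊m/2⌋<n : ∀ m {n} → m < 2 * n → ⌊ m /2⌋ < n
m<2n⇒⌊m/2⌋<n _             {zero}  ()
m<2n⇒⌊m/2⌋<n zero          {suc n} _ = z<s
m<2n⇒⌊m/2⌋<n (suc zero)    {suc n} _ = z<s
m<2n⇒⌊m/2⌋<n (suc (suc m)) {suc n} m+2<2n+2 =
  s<s (m<2n⇒⌊m/2⌋<n m (s<s⁻¹ (s<s⁻¹ (subst (3 + m ≤_) (*-suc 2 n) m+2<2n+2))))

⌊m/2⌋≡⌊n/2⌋⇒m≡n⊎consecutive : ∀ m n → ⌊ m /2⌋ ≡ ⌊ n /2⌋ → m ≡ n ⊎ Consecutive m n
⌊m/2⌋≡⌊n/2⌋⇒m≡n⊎consecutive zero          zero          _  = inj₁ refl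
⌊m/2⌋≡⌊n/2⌋⇒m≡n⊎consecutive zero          (suc zero)    _  = inj₂ (inj₁ refl)
⌊m/2⌋≡⌊n/2⌋⇒m≡n⊎consecutive (suc zero)    zero          _  = inj₂ (inj₂ refl)
⌊m/2⌋≡⌊n/2⌋⇒m≡n⊎consecutive (suc zero)    (suc zero)    _  = inj₁ refl
⌊m/2⌋≡⌊n/2⌋⇒m≡n⊎consecutive (suc (suc m)) (suc (suc n)) eq =
  Sum.map (cong (2 +_)) (Sum.map (cong (2 +_)) (cong (2 +_)))
          (⌊m/2⌋≡⌊n/2⌋⇒m≡n⊎consecutive m n (suc-injective eq))

even⊎odd : ∀ m → m ≡ 2 * ⌊ m /2⌋ ⊎ m ≡ suc (2 * ⌊ m /2⌋)
even⊎odd zero       = inj₁ refl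
even⊎odd (suc zero) = inj₂ refl
even⊎odd (suc (suc m)) rewrite *-suc 2 ⌊ m /2⌋ =
  Sum.map (cong (2 +_)) (cong (2 +_)) (even⊎odd m)

o+2m≢consecutive : ∀ o m n → suc (o + 2 * m) ≢ o + 2 * n
o+2m≢consecutive o m n eq =
  even≢odd n m (sym (+-cancelˡ-≡ o _ _ (trans (+-suc o (2 * m)) eq)))

module _ {P : Set} where

  offset : Dec P → ℕ
  offset (yes _) = 1
  offset (no _)  = 0

  offset-yes : P → (d : Dec P) → offset d ≡ 1
  offset-yes _ (yes _) = refl
  offset-yes p (no ¬p) = contradiction p ¬p

  offset-no : ¬ P → (d : Dec P) → offset d ≡ 0
  offset-no ¬p (yes p) = contradiction p ¬p
  offset-no _  (no _)  = refl

  offset+2m<2n : (d : Dec P) {m n : ℕ} → m < n → offset d + 2 * m < 2 * n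
  offset+2m<2n d {m} {suc n} (s≤s m≤n) = begin-strict
    offset d + 2 * m  <⟨ s≤s (+-monoˡ-≤ (2 * m) (offset≤1 d)) ⟩
    suc (suc (2 * m)) ≤⟨ s≤s (s≤s (*-monoʳ-≤ 2 m≤n)) ⟩
    suc (suc (2 * n)) ≡⟨ *-suc 2 n ⟨
    2 * suc n         ∎
    where
    open ≤-Reasoning
    offset≤1 : (d : Dec P) → offset d ≤ 1
    offset≤1 (yes _) = s≤s z≤n
    offset≤1 (no _)  = z≤n

  offset+2m<2n⇒m<n : (d : Dec P) {m n : ℕ} → offset d + 2 * m < 2 * n → m < n
  offset+2m<2n⇒m<n d {m} {n} lt =
    *-cancelˡ-< 2 m n (≤-trans (s≤s (m≤n+m (2 * m) (offset d))) lt)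

  spread : ∀ {k} → Dec P → Fin k → Fin (2 * k)
  spread d j = fromℕ< (offset+2m<2n d (Finₚ.toℕ<n j))

  toℕ-spread : ∀ {k} (d : Dec P) (j : Fin k) → toℕ (spread d j) ≡ offset d + 2 * toℕ j
  toℕ-spread d j = Finₚ.toℕ-fromℕ< _

  spread-injective : ∀ {k} (d : Dec P) {j j′ : Fin k} →
                     toℕ (spread d j) ≡ toℕ (spread d j′) → toℕ j ≡ toℕ j′
  spread-injective d {j} {j′} eq = *-cancelˡ-≡ _ _ 2 (+-cancelˡ-≡ (offset d) _ _
    (trans (sym (toℕ-spread d j)) (trans eq (toℕ-spread d j′))))

  spread-not-consecutive : ∀ {k} (d : Dec P) (j j′ : Fin k) →
                           ¬ Consecutive (toℕ (spread d j)) (toℕ (spread d j′))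
  spread-not-consecutive d j j′ rewrite toℕ-spread d j | toℕ-spread d j′ = λ where
    (inj₁ eq) → o+2m≢consecutive (offset d) (toℕ j) (toℕ j′) eq
    (inj₂ eq) → o+2m≢consecutive (offset d) (toℕ j′) (toℕ j) eq

  squeeze : Dec P → ℕ → ℕ
  squeeze (yes _) m = ⌊ pred m /2⌋
  squeeze (no _)  m = ⌊ m /2⌋

  squeeze-< : (d : Dec P) {m k : ℕ} → m < 2 * k → squeeze d m < k
  squeeze-< (yes _) {m} m<2k = m<2n⇒⌊m/2⌋<n (pred m) (≤-<-trans pred[n]≤n m<2k)
  squeeze-< (no _)  {m} m<2k = m<2n⇒⌊m/2⌋<n m m<2k

  squeeze-<-∸1 : (d : Dec P) → P → ∀ {m k} → m ≢ 0 → suc m < 2 * k → squeeze d m < k ∸ 1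
  squeeze-<-∸1 (no ¬p) p = contradiction p ¬p
  squeeze-<-∸1 (yes _) _ {zero}          m≢0 _ = contradiction refl m≢0
  squeeze-<-∸1 (yes _) _ {suc m} {zero}  _   ()
  squeeze-<-∸1 (yes _) _ {suc m} {suc k} _   m+2<2k+2 =
    m<2n⇒⌊m/2⌋<n m (s<s⁻¹ (s<s⁻¹ (subst (3 + m ≤_) (*-suc 2 k) m+2<2k+2)))

  squeeze-≡ : (d : Dec P) {m m′ : ℕ} → (P → m ≢ 0) → (P → m′ ≢ 0) →
              squeeze d m ≡ squeeze d m′ → m ≡ m′ ⊎ Consecutive m m′
  squeeze-≡ (no _)  {m} {m′} _ _ eq = ⌊m/2⌋≡⌊n/2⌋⇒m≡n⊎consecutive m m′ eq
  squeeze-≡ (yes p) {zero}           m≢0 _    _  = contradiction refl (m≢0 p)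
  squeeze-≡ (yes p) {suc _} {zero}   _   m′≢0 _  = contradiction refl (m′≢0 p)
  squeeze-≡ (yes _) {suc m} {suc m′} _   _    eq =
    Sum.map (cong suc) (Sum.map (cong suc) (cong suc))
            (⌊m/2⌋≡⌊n/2⌋⇒m≡n⊎consecutive m m′ eq)

module EvenSubdivision {n : ℕ} (G : SimpleGraph n) (k : Fin n → Fin n → ℕ) where

  open import Data.List.Membership.DecPropositional (Finₚ._≟_ {n}) using (_∈?_)

  V : Set
  V = SubV G k

  E : V → V → Set
  E = SubAdj G k

  Adj-sym : ∀ {x y} → Adj G x y → Adj G y x
  Adj-sym {x} {y} xy = trans (symm G y x) xy

  Adj-irrefl : ∀ {x} → ¬ Adj G x x
  Adj-irrefl {x} xx with () ← trans (sym (irrefl G x)) xx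

  adj? : ∀ x y → Dec (Adj G x y)
  adj? x y = adj G x y Bool.≟ true

  edge? : ∀ u v → Dec (Edge G u v)
  edge? u v = (u Finₚ.<? v) ×-dec adj? u v

  Edge-irrelevant : ∀ {u v} (e e′ : Edge G u v) → e ≡ e′
  Edge-irrelevant (u<v , uv) (u<v′ , uv′) = cong₂ _,_ (Finₚ.<-irrelevant u<v u<v′) (uip uv uv′)

  E-originals⇒Adj : ∀ {x y} → E (inj₁ x) (inj₁ y) → Adj G x y
  E-originals⇒Adj (inj₁ ((_ , xy) , _)) = xy
  E-originals⇒Adj (inj₂ ((_ , yx) , _)) = Adj-sym yx

  internal-≡ : ∀ {u v} {e e′ : Edge G u v} {i i′ : Fin (2 * k u v)} → toℕ i ≡ toℕ i′ →
               _≡_ {A = V} (inj₂ (u , v , e , i)) (inj₂ (u , v , e′ , i′))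
  internal-≡ {e = e} {e′} i≡i′ rewrite Edge-irrelevant e e′ | Finₚ.toℕ-injective i≡i′ = refl

  internal-injective : ∀ {u u′ v v′} {e : Edge G u v} {e′ : Edge G u′ v′}
                         {i : Fin (2 * k u v)} {i′ : Fin (2 * k u′ v′)} →
                       _≡_ {A = V} (inj₂ (u , v , e , i)) (inj₂ (u′ , v′ , e′ , i′)) →
                       u ≡ u′ × v ≡ v′ × toℕ i ≡ toℕ i′
  internal-injective refl = refl , refl , refl

  -- The j-th of the k u v slots of an edge u v stands for the internal vertices
  -- 2 j and 2 j + 1 of its path.
  Slot : Set
  Slot = ∃₂ λ u v → Edge G u v × Fin (k u v)

  slot-≡ : ∀ {u v} {e e′ : Edge G u v} {j j′ : Fin (k u v)} → toℕ j ≡ toℕ j′ →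
           _≡_ {A = Slot} (u , v , e , j) (u , v , e′ , j′)
  slot-≡ {e = e} {e′} j≡j′ rewrite Edge-irrelevant e e′ | Finₚ.toℕ-injective j≡j′ = refl

  slotsOn : ∀ u v → Dec (Edge G u v) → List Slot
  slotsOn u v (yes e) = tabulate (λ j → u , v , e , j)
  slotsOn u v (no _)  = []

  slotsAt : Fin n × Fin n → List Slot
  slotsAt (u , v) = slotsOn u v (edge? u v)

  slots : List Slot
  slots = concatMap slotsAt (cartesianProduct (allFin n) (allFin n))

  ∈-slots : ∀ s → s ∈ slots
  ∈-slots (u , v , e , j) = ∈-concatMap⁺ slotsAt
    (lose (∈-cartesianProduct⁺ (∈-allFin u) (∈-allFin v)) (∈-slotsOn (edge? u v)))
    where
    ∈-slotsOn : (d : Dec (Edge G u v)) → (u , v , e , j) ∈ slotsOn u v d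
    ∈-slotsOn (yes e′) rewrite Edge-irrelevant e e′ = ∈-tabulate⁺ j
    ∈-slotsOn (no ¬e)  = contradiction e ¬e

  slots-unique : Unique slots
  slots-unique =
    concatMap⁺ ends (cartesianProduct⁺ (allFin⁺ n) (allFin⁺ n)) slotsAt-unique slotsAt-ends
    where
    ends : Slot → Fin n × Fin n
    ends (u , v , _) = u , v
    slotsAt-unique : ∀ uv → Unique (slotsAt uv)
    slotsAt-unique (u , v) with edge? u v
    ... | yes e = tabulate⁺ λ { refl → refl }
    ... | no _  = []
    slotsAt-ends : ∀ {uv s} → s ∈ slotsAt uv → ends s ≡ uv
    slotsAt-ends {u , v} p with edge? u v
    slotsAt-ends {u , v} p | yes e with ∈-tabulate⁻ p
    ... | _ , refl = refl
    slotsAt-ends {u , v} () | no _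

  place : List (Fin n) → Slot → V
  place S (u , v , e , j) = inj₂ (u , v , e , spread (u ∈? S) j)

  lift : List (Fin n) → List V
  lift S = map inj₁ S ++ map (place S) slots

  length-lift : ∀ S → length (lift S) ≡ length S + length slots
  length-lift S = trans (length-++ (map inj₁ S))
                        (cong₂ _+_ (length-map inj₁ S) (length-map (place S) slots))

  place-injective : ∀ S {s s′} → place S s ≡ place S s′ → s ≡ s′
  place-injective S {u , v , e , j} {u′ , v′ , e′ , j′} eq with internal-injective eq
  ... | refl , refl , i≡i′ = slot-≡ (spread-injective (u ∈? S) i≡i′)

  lift-unique : ∀ {S} → Unique S → Unique (lift S)
  lift-unique {S} S! =
    ++⁺ (map⁺ inj₁-injective S!) (map⁺ (place-injective S) slots-unique) disjoint
    where
    disjoint : ∀ {z} → ¬ (z ∈ map inj₁ S × z ∈ map (place S) slots)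
    disjoint (p , q) with ∈-map⁻ inj₁ p | ∈-map⁻ (place S) q
    ... | _ , _ , refl | (_ , _ , _ , _) , _ , ()

  ∈-lift⁻ : ∀ {S z} → z ∈ lift S → (∃ λ a → a ∈ S × z ≡ inj₁ a) ⊎ (∃ λ s → z ≡ place S s)
  ∈-lift⁻ {S} p with ∈-++⁻ (map inj₁ S) p
  ... | inj₁ q = inj₁ (∈-map⁻ inj₁ q)
  ... | inj₂ q with ∈-map⁻ (place S) q
  ...   | s , _ , z≡ = inj₂ (s , z≡)

  lift-independent : ∀ {S} → Independent (Adj G) S → Independent E (lift S)
  lift-independent {S} (S! , S-indep) = lift-unique S! , indep
    where
    not-attached : ∀ {a} → a ∈ S → ∀ u v e j → ¬ E (inj₁ a) (place S (u , v , e , j))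
    not-attached a∈S u v e j (inj₁ (refl , i≡0)) = 1+n≢0 (begin
      suc (2 * toℕ j)                    ≡⟨ cong (_+ 2 * toℕ j) (offset-yes a∈S (u ∈? S)) ⟨
      offset (u ∈? S) + 2 * toℕ j        ≡⟨ toℕ-spread (u ∈? S) j ⟨
      toℕ (spread (u ∈? S) j)            ≡⟨ i≡0 ⟩
      0                                  ∎)
      where open ≡-Reasoning
    not-attached a∈S u v e j (inj₂ (refl , last)) with u ∈? S
    ... | yes u∈S = S-indep u∈S a∈S (proj₂ e)
    ... | no u∉S  = even≢odd (k u v) (toℕ j) (sym (trans (cong suc (sym (toℕ-spread (no u∉S) j))) last))

    places-not-adjacent : ∀ s s′ → ¬ E (place S s) (place S s′)
    places-not-adjacent (u , v , e , j) (_ , _ , _ , j′) (refl , refl , consecutive) =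
      spread-not-consecutive (u ∈? S) j j′ consecutive

    indep : ∀ {x y} → x ∈ lift S → y ∈ lift S → ¬ E x y
    indep p q with ∈-lift⁻ p | ∈-lift⁻ q
    ... | inj₁ (_ , a∈S , refl) | inj₁ (_ , b∈S , refl) = S-indep a∈S b∈S ∘ E-originals⇒Adj
    ... | inj₁ (_ , a∈S , refl) | inj₂ ((u , v , e , j) , refl) = not-attached a∈S u v e j
    ... | inj₂ ((u , v , e , j) , refl) | inj₁ (_ , a∈S , refl) = not-attached a∈S u v e j
    ... | inj₂ (s , refl) | inj₂ (s′ , refl) = places-not-adjacent s s′

  ∈-lift-original : ∀ {S a} → a ∈ S → inj₁ a ∈ lift S
  ∈-lift-original a∈S = ∈-++⁺ˡ (∈-map⁺ inj₁ a∈S)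

  ∈-lift-internal : ∀ {S u v} (e : Edge G u v) (i : Fin (2 * k u v)) j →
                    toℕ i ≡ offset (u ∈? S) + 2 * j → inj₂ (u , v , e , i) ∈ lift S
  ∈-lift-internal {S} {u} {v} e i j i≡ = ∈-++⁺ʳ (map inj₁ S)
    (subst (_∈ map (place S) slots) (internal-≡ spread≡i)
           (∈-map⁺ (place S) (∈-slots (u , v , e , fromℕ< j<k))))
    where
    j<k : j < k u v
    j<k = offset+2m<2n⇒m<n (u ∈? S) (subst (_< 2 * k u v) i≡ (Finₚ.toℕ<n i))
    spread≡i : toℕ (spread (u ∈? S) (fromℕ< j<k)) ≡ toℕ i
    spread≡i = trans (toℕ-spread (u ∈? S) (fromℕ< j<k))
                     (trans (cong (λ m → offset (u ∈? S) + 2 * m) (Finₚ.toℕ-fromℕ< j<k)) (sym i≡))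

  ∈-lift-even : ∀ {S u v} (e : Edge G u v) (i : Fin (2 * k u v)) j →
                ¬ u ∈ S → toℕ i ≡ 2 * j → inj₂ (u , v , e , i) ∈ lift S
  ∈-lift-even {S} {u} e i j u∉S i≡ =
    ∈-lift-internal e i j (trans i≡ (cong (_+ 2 * j) (sym (offset-no u∉S (u ∈? S)))))

  ∈-lift-odd : ∀ {S u v} (e : Edge G u v) (i : Fin (2 * k u v)) j →
               u ∈ S → toℕ i ≡ suc (2 * j) → inj₂ (u , v , e , i) ∈ lift S
  ∈-lift-odd {S} {u} e i j u∈S i≡ =
    ∈-lift-internal e i j (trans i≡ (cong (_+ 2 * j) (sym (offset-yes u∈S (u ∈? S)))))

  originals : List V → List (Fin n)
  originals []             = []
  originals (inj₁ x ∷ zs) = x ∷ originals zs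
  originals (inj₂ _ ∷ zs) = originals zs

  ∈-originals⁺ : ∀ {x zs} → inj₁ x ∈ zs → x ∈ originals zs
  ∈-originals⁺ {zs = inj₁ _ ∷ _} (here refl) = here refl
  ∈-originals⁺ {zs = inj₁ _ ∷ _} (there p)   = there (∈-originals⁺ p)
  ∈-originals⁺ {zs = inj₂ _ ∷ _} (there p)   = ∈-originals⁺ p

  ∈-originals⁻ : ∀ {x zs} → x ∈ originals zs → inj₁ x ∈ zs
  ∈-originals⁻ {zs = inj₁ _ ∷ _} (here refl) = here refl
  ∈-originals⁻ {zs = inj₁ _ ∷ _} (there p)   = there (∈-originals⁻ p)
  ∈-originals⁻ {zs = inj₂ _ ∷ _} p           = there (∈-originals⁻ p)

  -- Slots without the bound j < k u v, so that charges can be assigned before that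
  -- bound is established.
  Coordinates : Set
  Coordinates = Fin n × Fin n × ℕ

  coordinates : Slot → Coordinates
  coordinates (u , v , _ , j) = u , v , toℕ j

  ,,-injective : ∀ {a a′ b b′ : Fin n} {m m′ : ℕ} →
                 _≡_ {A = Coordinates} (a , b , m) (a′ , b′ , m′) → a ≡ a′ × b ≡ b′ × m ≡ m′
  ,,-injective refl = refl , refl , refl

  coordinates-∈ : ∀ {u v m} → Edge G u v → m < k u v → (u , v , m) ∈ map coordinates slots
  coordinates-∈ {u} {v} e m<k = subst (λ m → (u , v , m) ∈ map coordinates slots)
    (Finₚ.toℕ-fromℕ< m<k) (∈-map⁺ coordinates (∈-slots (u , v , e , fromℕ< m<k)))

  SameEnds : Fin n → Fin n → Fin n → Fin n → Set
  SameEnds a b x y = (a ≡ x × b ≡ y) ⊎ (a ≡ y × b ≡ x)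

  SameEnds-preserves : ∀ {P : Fin n → Set} {a b x y} → SameEnds a b x y → P x → P y → P a × P b
  SameEnds-preserves (inj₁ (refl , refl)) px py = px , py
  SameEnds-preserves (inj₂ (refl , refl)) px py = py , px

  SameEnds-determines : ∀ {a b x y x′ y′} → SameEnds a b x y → SameEnds a b x′ y′ →
                        x ≡ x′ ⊎ (x ≡ y′ × y ≡ x′)
  SameEnds-determines (inj₁ (refl , refl)) (inj₁ (refl , refl)) = inj₁ refl
  SameEnds-determines (inj₁ (refl , refl)) (inj₂ (refl , refl)) = inj₂ (refl , refl)
  SameEnds-determines (inj₂ (refl , refl)) (inj₁ (refl , refl)) = inj₂ (refl , refl)
  SameEnds-determines (inj₂ (refl , refl)) (inj₂ (refl , refl)) = inj₁ refl

  orderedLastCoordinates : ∀ x y → Dec (x Fin.< y) → Coordinates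
  orderedLastCoordinates x y (yes _) = x , y , k x y ∸ 1
  orderedLastCoordinates x y (no _)  = y , x , k y x ∸ 1

  lastCoordinates : Fin n → Fin n → Coordinates
  lastCoordinates x y = orderedLastCoordinates x y (x Finₚ.<? y)

  lastCoordinates-spec : ∀ {x y} → Adj G x y →
    ∃₂ λ a b → lastCoordinates x y ≡ (a , b , k a b ∸ 1) × Edge G a b × SameEnds a b x y
  lastCoordinates-spec {x} {y} xy = spec (x Finₚ.<? y)
    where
    spec : (d : Dec (x Fin.< y)) → ∃₂ λ a b →
           orderedLastCoordinates x y d ≡ (a , b , k a b ∸ 1) × Edge G a b × SameEnds a b x y
    spec (yes x<y) = x , y , refl , (x<y , xy) , inj₁ (refl , refl)
    spec (no x≮y) with Finₚ.<-cmp x y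
    ... | tri< x<y _ _  = contradiction x<y x≮y
    ... | tri≈ _ refl _ = contradiction xy Adj-irrefl
    ... | tri> _ _ y<x  = y , x , refl , (y<x , Adj-sym xy) , inj₂ (refl , refl)

  lastCoordinates-injective : ∀ {x y x′ y′} → Adj G x y → Adj G x′ y′ →
    lastCoordinates x y ≡ lastCoordinates x′ y′ → x ≡ x′ ⊎ (x ≡ y′ × y ≡ x′)
  lastCoordinates-injective xy x′y′ eq
    with lastCoordinates-spec xy | lastCoordinates-spec x′y′
  ... | _ , _ , last≡ , _ , ends | _ , _ , last≡′ , _ , ends′
    with ,,-injective (trans (sym last≡) (trans eq last≡′))
  ... | refl , refl , _ = SameEnds-determines ends ends′

  module Projection (T : List V) (w : Fin n) where

    O : List (Fin n)
    O = originals T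

    -- y ≺ x: y has priority over x, so that x is the end removed from an edge x y.
    infix 4 _≺_
    _≺_ : Fin n → Fin n → Set
    y ≺ x = x ≢ w × (y ≡ w ⊎ y Fin.< x)

    _≺?_ : ∀ y x → Dec (y ≺ x)
    y ≺? x = ¬? (x Finₚ.≟ w) ×-dec ((y Finₚ.≟ w) ⊎-dec (y Finₚ.<? x))

    ≺-asym : ∀ {x y} → x ≺ y → ¬ y ≺ x
    ≺-asym (_ , inj₁ refl)   (x≢w , _)       = x≢w refl
    ≺-asym (y≢w , _)         (_ , inj₁ refl) = y≢w refl
    ≺-asym (_ , inj₂ x<y)    (_ , inj₂ y<x)  = Finₚ.<-asym x<y y<x

    ≺-connex : ∀ {x y} → x ≢ y → x ≺ y ⊎ y ≺ x
    ≺-connex {x} {y} x≢y with x Finₚ.≟ w | y Finₚ.≟ w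
    ... | yes refl | _        = inj₁ ((λ y≡w → x≢y (sym y≡w)) , inj₁ refl)
    ... | no x≢w   | yes refl = inj₂ (x≢w , inj₁ refl)
    ... | no x≢w   | no y≢w with Finₚ.<-cmp x y
    ...   | tri< x<y _ _  = inj₁ (y≢w , inj₂ x<y)
    ...   | tri≈ _ x≡y _  = contradiction x≡y x≢y
    ...   | tri> _ _ y<x  = inj₂ (x≢w , inj₂ y<x)

    Dominated : Fin n → Set
    Dominated x = ∃ λ y → y ∈ O × Adj G x y × y ≺ x

    dominated? : ∀ x → Dec (Dominated x)
    dominated? x = Finₚ.any? λ y → (y ∈? O) ×-dec (adj? x y ×-dec (y ≺? x))

    Kept : Fin n → Set
    Kept x = x ∈ O × ¬ Dominated x

    kept? : ∀ x → Dec (Kept x)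
    kept? x = (x ∈? O) ×-dec ¬? (dominated? x)

    project : List (Fin n)
    project = filter kept? (allFin n)

    ∈-project⁺ : ∀ {x} → Kept x → x ∈ project
    ∈-project⁺ {x} = ∈-filter⁺ kept? (∈-allFin x)

    ∈-project⁻ : ∀ {x} → x ∈ project → Kept x
    ∈-project⁻ = proj₂ ∘ ∈-filter⁻ kept? {xs = allFin n}

    project-independent : Independent (Adj G) project
    project-independent = filter⁺ kept? (allFin⁺ n) , indep
      where
      indep : ∀ {x y} → x ∈ project → y ∈ project → ¬ Adj G x y
      indep {x} {y} p q xy with ∈-project⁻ p | ∈-project⁻ q | x Finₚ.≟ y
      ... | _ | _ | yes refl = Adj-irrefl xy
      ... | x∈O , ¬x-dominated | y∈O , ¬y-dominated | no x≢y with ≺-connex x≢y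
      ...   | inj₁ x≺y = ¬y-dominated (x , x∈O , Adj-sym xy , x≺y)
      ...   | inj₂ y≺x = ¬x-dominated (y , y∈O , xy , y≺x)

    w∈project : inj₁ w ∈ T → w ∈ project
    w∈project p = ∈-project⁺ (∈-originals⁺ p , λ { (_ , _ , _ , w≢w , _) → w≢w refl })

    -- Charge kept vertices to themselves, a removed vertex to the last slot of the
    -- edge to the vertex that dominates it, and an internal vertex to the slot it
    -- occupies (shifted by one when the path starts in T); this injects T into
    -- project plus the slots.
    chargeOriginal : ∀ x → Dec (Dominated x) → Fin n ⊎ Coordinates
    chargeOriginal x (yes (y , _)) = inj₂ (lastCoordinates x y)
    chargeOriginal x (no _)        = inj₁ x

    charge : V → Fin n ⊎ Coordinates
    charge (inj₁ x)               = chargeOriginal x (dominated? x)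
    charge (inj₂ (u , v , _ , i)) = inj₂ (u , v , squeeze (u ∈? O) (toℕ i))

    data OriginalCharge (x : Fin n) : Fin n ⊎ Coordinates → Set where
      kept      : ¬ Dominated x → OriginalCharge x (inj₁ x)
      dominated : ∀ {y} → y ∈ O → Adj G x y → y ≺ x →
                  OriginalCharge x (inj₂ (lastCoordinates x y))

    originalCharge : ∀ x → OriginalCharge x (charge (inj₁ x))
    originalCharge x = view (dominated? x)
      where
      view : (d : Dec (Dominated x)) → OriginalCharge x (chargeOriginal x d)
      view (yes (_ , y∈O , xy , y≺x)) = dominated y∈O xy y≺x
      view (no ¬dominated)            = kept ¬dominated

    positions : List (Fin n ⊎ Coordinates)
    positions = map inj₁ project ++ map inj₂ (map coordinates slots)

    length-positions : length positions ≡ length project + length slots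
    length-positions = trans (length-++ (map inj₁ project)) (cong₂ _+_
      (length-map inj₁ project)
      (trans (length-map inj₂ (map coordinates slots)) (length-map coordinates slots)))

    module _ (T-indep : ∀ {x y} → x ∈ T → y ∈ T → ¬ E x y) where

      k≢0 : ∀ {a b} → a ∈ O → b ∈ O → Edge G a b → k a b ≢ 0
      k≢0 a∈O b∈O e k≡0 = T-indep (∈-originals⁻ a∈O) (∈-originals⁻ b∈O) (inj₁ (e , k≡0))

      internal-≢0 : ∀ {u v e i} → inj₂ (u , v , e , i) ∈ T → u ∈ O → toℕ i ≢ 0
      internal-≢0 p u∈O i≡0 = T-indep (∈-originals⁻ u∈O) p (inj₁ (refl , i≡0))

      internal-≢last : ∀ {u v e i} → inj₂ (u , v , e , i) ∈ T → v ∈ O → suc (toℕ i) ≢ 2 * k u v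
      internal-≢last p v∈O last = T-indep (∈-originals⁻ v∈O) p (inj₂ (refl , last))

      lastCoordinates-∈ : ∀ {x y} → x ∈ O → y ∈ O → Adj G x y →
                          lastCoordinates x y ∈ map coordinates slots
      lastCoordinates-∈ x∈O y∈O xy with lastCoordinates-spec xy
      ... | _ , _ , last≡ , e , ends rewrite last≡ =
        let a∈O , b∈O = SameEnds-preserves ends x∈O y∈O
        in coordinates-∈ e (∸-monoʳ-< z<s (n≢0⇒n>0 (k≢0 a∈O b∈O e)))

      charge-∈ : ∀ {z} → z ∈ T → charge z ∈ positions
      charge-∈ {inj₁ x} p with charge (inj₁ x) | originalCharge x
      ... | _ | kept ¬dominated =
        ∈-++⁺ˡ (∈-map⁺ inj₁ (∈-project⁺ (∈-originals⁺ p , ¬dominated)))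
      ... | _ | dominated y∈O xy _ =
        ∈-++⁺ʳ (map inj₁ project) (∈-map⁺ inj₂ (lastCoordinates-∈ (∈-originals⁺ p) y∈O xy))
      charge-∈ {inj₂ (u , v , e , i)} _ = ∈-++⁺ʳ (map inj₁ project)
        (∈-map⁺ inj₂ (coordinates-∈ e (squeeze-< (u ∈? O) (Finₚ.toℕ<n i))))

      -- The last slot of an edge with both ends in T is free, since the path then
      -- carries at most k - 1 vertices of T.
      original≢internal : ∀ {x u v e i} → inj₁ x ∈ T → inj₂ (u , v , e , i) ∈ T →
                          charge (inj₁ x) ≢ charge (inj₂ (u , v , e , i))
      original≢internal {x} {u} {v} {e} {i} p p′ eq with charge (inj₁ x) | originalCharge x
      ... | _ | kept _ with () ← eq
      ... | _ | dominated y∈O xy _ with lastCoordinates-spec xy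
      ...   | _ , _ , last≡ , _ , ends with ,,-injective (trans (sym last≡) (inj₂-injective eq))
      ...     | refl , refl , k∸1≡squeeze =
        let u∈O , v∈O = SameEnds-preserves ends (∈-originals⁺ p) y∈O
        in <-irrefl (sym k∸1≡squeeze)
             (squeeze-<-∸1 (u ∈? O) u∈O {toℕ i} {k u v} (internal-≢0 p′ u∈O)
                           (≤∧≢⇒< (Finₚ.toℕ<n i) (internal-≢last p′ v∈O)))

      charge-injective : ∀ {z z′} → z ∈ T → z′ ∈ T → charge z ≡ charge z′ → z ≡ z′
      charge-injective {inj₁ x} {inj₁ x′} p p′ eq
        with charge (inj₁ x) | originalCharge x | charge (inj₁ x′) | originalCharge x′
      ... | _ | kept _ | _ | kept _ = cong inj₁ (inj₁-injective eq)
      ... | _ | kept _ | _ | dominated _ _ _ with () ← eq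
      ... | _ | dominated _ _ _ | _ | kept _ with () ← eq
      ... | _ | dominated _ xy y≺x | _ | dominated _ x′y′ y′≺x′
        with lastCoordinates-injective xy x′y′ (inj₂-injective eq)
      ...   | inj₁ x≡x′ = cong inj₁ x≡x′
      ...   | inj₂ (refl , refl) = ⊥-elim (≺-asym y≺x y′≺x′)
      charge-injective {inj₁ _} {inj₂ _} p p′ eq = ⊥-elim (original≢internal p p′ eq)
      charge-injective {inj₂ _} {inj₁ _} p p′ eq = ⊥-elim (original≢internal p′ p (sym eq))
      charge-injective {inj₂ (u , v , e , i)} {inj₂ (_ , _ , _ , i′)} p p′ eq
        with ,,-injective (inj₂-injective eq)
      ... | refl , refl , squeeze≡
        with squeeze-≡ (u ∈? O) (internal-≢0 p) (internal-≢0 p′) squeeze≡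
      ...   | inj₁ i≡i′       = internal-≡ i≡i′
      ...   | inj₂ consecutive = ⊥-elim (T-indep p p′ (refl , refl , consecutive))

      length-project : Unique T → length T ≤ length project + length slots
      length-project T! = begin
        length T                      ≤⟨ length-≤-injectiveOn charge T! charge-∈ charge-injective ⟩
        length positions              ≡⟨ length-positions ⟩
        length project + length slots ∎
        where open ≤-Reasoning

    project-maximum : MaximumIndependent E T → MaximumIndependent (Adj G) project
    project-maximum ((T! , T-indep) , T-max) = project-independent , λ S S-indep →
      +-cancelʳ-≤ (length slots) _ _ (begin
        length S + length slots        ≡⟨ length-lift S ⟨
        length (lift S)                ≤⟨ T-max (lift S) (lift-independent S-indep) ⟩
        length T                       ≤⟨ length-project T-indep T! ⟩
        length project + length slots  ∎)
      where open ≤-Reasoning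

  projection-bound : ∀ {T} → Independent E T →
                     ∃ λ S → Independent (Adj G) S × length T ≤ length S + length slots
  projection-bound {[]} _ = [] , ([] , λ ()) , z≤n
  projection-bound {T@(z ∷ _)} (T! , T-indep) =
    project , project-independent , length-project T-indep T!
    where
    anchor : V → Fin n
    anchor (inj₁ x)       = x
    anchor (inj₂ (u , _)) = u
    open Projection T (anchor z)

  lift-maximum : ∀ {S} → MaximumIndependent (Adj G) S → MaximumIndependent E (lift S)
  lift-maximum {S} (S-indep , S-max) = lift-independent S-indep , λ T T-indep →
    let S′ , S′-indep , T≤S′+slots = projection-bound T-indep in begin
      length T                  ≤⟨ T≤S′+slots ⟩
      length S′ + length slots  ≤⟨ +-monoˡ-≤ (length slots) (S-max S′ S′-indep) ⟩
      length S + length slots   ≡⟨ length-lift S ⟨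
      length (lift S)           ∎
    where open ≤-Reasoning

lemma3 : (n : ℕ) (G : SimpleGraph n) (k : Fin n → Fin n → ℕ) →
         OneExtendable (Adj G) ⇔ OneExtendable (SubAdj G k)
lemma3 n G k = mk⇔ extend restrict
  where
  open EvenSubdivision G k

  extend : OneExtendable (Adj G) → OneExtendable (SubAdj G k)
  extend ext (inj₁ x) with ext x
  ... | S , S-max , x∈S = lift S , lift-maximum S-max , ∈-lift-original x∈S
  extend ext (inj₂ (u , v , e , i)) with even⊎odd (toℕ i)
  ... | inj₁ even with ext v
  ...   | S , S-max@((_ , S-indep) , _) , v∈S = lift S , lift-maximum S-max ,
          ∈-lift-even e i ⌊ toℕ i /2⌋ (λ u∈S → S-indep u∈S v∈S (proj₂ e)) even
  extend ext (inj₂ (u , v , e , i)) | inj₂ odd with ext u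
  ...   | S , S-max , u∈S = lift S , lift-maximum S-max , ∈-lift-odd e i ⌊ toℕ i /2⌋ u∈S odd

  restrict : OneExtendable (SubAdj G k) → OneExtendable (Adj G)
  restrict ext x with ext (inj₁ x)
  ... | T , T-max , x∈T = project , project-maximum T-max , w∈project x∈T
    where open Projection T x
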